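{- Assume the following statement (H): for all positive integers $a$ and $m$ with $m>1$, if $a<p$ where $p$ is the least prime divisor of $m$, and $m\mid\varphi(am+1)$, then $am+1$ is prime. Under (H), the following holds: let $a$ and $m>1$ be positive integers, let $p$ be the least prime divisor of $m$, suppose $a<p$, and let $n=am+1$. If for each prime $q$ dividing $m$ there exists an integer $b$ (depending on $q$) such that $b^{n-1}\equiv 1\pmod n$ and $b^{(n-1)/q}\not\equiv 1\pmod n$, then $n$ is prime.
   Context: $\varphi$ denotes Euler's totient function. The statement (H) is a conjecture in the paper; the theorem is conditional on it. -}

module Defs where

open import Data.Nat using (ℕ; suc; _≤_; _<_; _*_; _+_; _∸_; NonZero)
open import Data.Nat.DivMod using (_/_)
open import Data.Nat.GCD using (gcd)
open import Data.Nat.Primality using (Prime; prime⇒nonZero)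
open import Data.Nat.Divisibility using (_∣_)
open import Data.List using (List; filter; length; upTo; map)
open import Relation.Binary.PropositionalEquality using (_≡_)
open import Data.Nat.Properties using (_≟_)
open import Relation.Nullary using (¬_)
import Data.Integer as ℤ
import Data.Integer.Divisibility as ℤ

φ : ℕ → ℕ
φ n = length (filter (λ k → gcd k n ≟ 1) (map suc (upTo n)))

LeastPrimeDivisor : ℕ → ℕ → Set
LeastPrimeDivisor p m = Prime p × p ∣ m × (∀ q → Prime q → q ∣ m → p ≤ q)
  where open import Data.Product using (_×_)

_≡_[modℤ_] : ℤ.ℤ → ℤ.ℤ → ℕ → Set
x ≡ y [modℤ n ] = (ℤ.+ n) ℤ.∣ (x ℤ.- y)

_/ᵖ_ : (k q : ℕ) → Prime q → ℕ
(k /ᵖ q) pq = _/_ k q {{prime⇒nonZero pq}}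

HypothesisH : Set
HypothesisH = ∀ (a m p : ℕ) → 1 ≤ a → 1 < m → LeastPrimeDivisor p m → a < p →
  m ∣ φ (a * m + 1) → Prime (a * m + 1)

module Submission where

-- Write n = N + 1 with N = a m and let d = gcd N φ(n). A witness b satisfies b^N ≡ 1, so it is a
-- unit mod n; Euler's theorem gives b^φ(n) ≡ 1 and Bézout then b^d ≡ 1. If a prime q divided both
-- m and N/d, then b^(N/q) would be a power of b^d, hence ≡ 1, contradicting the choice of b. So m
-- is coprime to N/d, whence m ∣ d ∣ φ(n), and (H) makes n prime.

open import Defs
open import Data.Nat using (ℕ; zero; suc; NonZero; _≤_; _<_; z≤n; s≤s)
import Data.Nat as ℕ
import Data.Nat.Properties as ℕ
import Data.Nat.Divisibility as ℕ
open import Data.Nat.DivMod using (_/_; *-/-assoc)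
open import Data.Nat.GCD using (gcd; gcd-GCD; module Bézout; gcd-identityˡ; gcd-greatest; gcd[m,n]∣m; gcd[m,n]∣n)
open import Data.Nat.Coprimality as Coprimality using (Coprime; 1-coprimeTo; gcd≡1⇒coprime; coprime⇒gcd≡1)
open import Data.Nat.Primality using (Prime; prime⇒nonZero)
open import Data.Nat.Primality.Factorisation using (factorise)
open import Data.Fin as Fin using (Fin; toℕ; fromℕ<)
open import Data.Fin.Properties using (toℕ-fromℕ<; toℕ-injective; toℕ<n)
open import Data.Fin.Permutation using (Permutation; permutation; _⟨$⟩ʳ_)
open import Data.List using (List; []; _∷_; [_]; _++_; length; filter; applyUpTo; upTo)
open import Data.List.Properties using (filter-accept; filter-reject; filter-++; length-++; upTo-∷ʳ; map-applyUpTo)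
open import Data.List.Relation.Unary.All using (_∷_)
open import Data.Product using (∃; _×_; _,_)
open import Algebra.Bundles using (CommutativeMonoid)
open import Algebra.Structures using (IsCommutativeMonoid)
open import Function using (_∘_; id)
open import Level using (0ℓ)
open import Relation.Binary.Bundles using (Setoid)
open import Relation.Binary.Structures using (IsEquivalence)
open import Relation.Binary.PropositionalEquality using (_≡_; _≢_; refl; sym; trans; cong; cong₂; subst; module ≡-Reasoning)
import Relation.Binary.Reasoning.Setoid
open import Relation.Nullary using (¬_; Dec; yes; no; contradiction)
import Data.Integer as ℤ
import Data.Integer.Properties as ℤ

coprime-* : ∀ {x y n} → Coprime x n → Coprime y n → Coprime (x ℕ.* y) n
coprime-* {x} {y} x⊥n y⊥n {d} (d∣xy , d∣n) = y⊥n (Coprimality.coprime-divisor d⊥x d∣xy , d∣n)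
  where
  d⊥x : Coprime d x
  d⊥x (e∣d , e∣x) = x⊥n (e∣x , ℕ.∣-trans e∣d d∣n)

module Congruence (n : ℕ) where

  open import Data.Integer using (ℤ; +_; 1ℤ; _*_; _-_; _+_; -_; _^_; ∣_∣)
  open import Data.Integer.Properties
    using (^-zeroˡ; +-injective; +-inverseʳ; abs-*; m-n≡m⊖n; ∣m⊝n∣≤m⊔n; ∣i∣≡0⇒i≡0; i-j≡0⇒i≡j)
  open import Data.Integer.DivMod using (_%ℕ_; _/ℕ_; n%ℕd<d; a≡a%ℕn+[a/ℕn]*n)
  open import Data.Integer.Divisibility.Signed as Signed
    using (divides; ∣ᵤ⇒∣; ∣⇒∣ᵤ; ∣m∣n⇒∣m+n; ∣m∣n⇒∣m-n; ∣m⇒∣-m; ∣m⇒∣m*n; ∣n⇒∣m*n)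
  import Data.Integer.Coprimality as ℤ
  open import Data.Integer.Tactic.RingSolver using (solve-∀)

  -- A record wrapping signed divisibility rather than the relation x ≡ y [modℤ n ] itself, so that
  -- x and y can be inferred from a proof (ℤ's _*_ and _-_ unfold and block unification).
  infix 4 _≈_
  record _≈_ (x y : ℤ) : Set where
    constructor mk≈
    field n∣x-y : + n Signed.∣ x - y

  modℤ⇒≈ : ∀ {x y} → x ≡ y [modℤ n ] → x ≈ y
  modℤ⇒≈ = mk≈ ∘ ∣ᵤ⇒∣

  ≈⇒modℤ : ∀ {x y} → x ≈ y → x ≡ y [modℤ n ]
  ≈⇒modℤ (mk≈ n∣x-y) = ∣⇒∣ᵤ n∣x-y

  ≈-refl : ∀ {x} → x ≈ x
  ≈-refl {x} = mk≈ (subst (+ n Signed.∣_) (sym (+-inverseʳ x)) (divides (+ 0) refl))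

  ≈-reflexive : ∀ {x y} → x ≡ y → x ≈ y
  ≈-reflexive refl = ≈-refl

  ≈-sym : ∀ {x y} → x ≈ y → y ≈ x
  ≈-sym {x} {y} (mk≈ n∣x-y) = mk≈ (subst (+ n Signed.∣_) (negate x y) (∣m⇒∣-m n∣x-y))
    where
    negate : ∀ x y → - (x - y) ≡ y - x
    negate = solve-∀

  ≈-trans : ∀ {x y z} → x ≈ y → y ≈ z → x ≈ z
  ≈-trans {x} {y} {z} (mk≈ n∣x-y) (mk≈ n∣y-z) =
    mk≈ (subst (+ n Signed.∣_) (telescope x y z) (∣m∣n⇒∣m+n n∣x-y n∣y-z))
    where
    telescope : ∀ x y z → (x - y) + (y - z) ≡ x - z
    telescope = solve-∀

  ≈-isEquivalence : IsEquivalence _≈_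
  ≈-isEquivalence = record { refl = ≈-refl ; sym = ≈-sym ; trans = ≈-trans }

  ≈-setoid : Setoid 0ℓ 0ℓ
  ≈-setoid = record { isEquivalence = ≈-isEquivalence }

  module ≈-Reasoning = Relation.Binary.Reasoning.Setoid ≈-setoid

  *-cong : ∀ {x x′ y y′} → x ≈ x′ → y ≈ y′ → x * y ≈ x′ * y′
  *-cong {x} {x′} {y} {y′} (mk≈ n∣x-x′) (mk≈ n∣y-y′) =
    mk≈ (subst (+ n Signed.∣_) (split x x′ y y′)
               (∣m∣n⇒∣m+n (∣m⇒∣m*n y n∣x-x′) (∣n⇒∣m*n x′ n∣y-y′)))
    where
    split : ∀ x x′ y y′ → (x - x′) * y + x′ * (y - y′) ≡ x * y - x′ * y′
    split = solve-∀

  *-1-isCommutativeMonoid : IsCommutativeMonoid _≈_ _*_ 1ℤ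
  *-1-isCommutativeMonoid = record
    { isMonoid = record
      { isSemigroup = record
        { isMagma = record { isEquivalence = ≈-isEquivalence ; ∙-cong = *-cong }
        ; assoc = λ x y z → ≈-reflexive (ℤ.*-assoc x y z)
        }
      ; identity = (λ x → ≈-reflexive (ℤ.*-identityˡ x)) , (λ x → ≈-reflexive (ℤ.*-identityʳ x))
      }
    ; comm = λ x y → ≈-reflexive (ℤ.*-comm x y)
    }

  *-1-commutativeMonoid : CommutativeMonoid 0ℓ 0ℓ
  *-1-commutativeMonoid = record { isCommutativeMonoid = *-1-isCommutativeMonoid }

  open import Algebra.Properties.CommutativeMonoid.Sum *-1-commutativeMonoid renaming (sum to ∏)

  ≈1-comm : ∀ r s → r * s ≈ 1ℤ → s * r ≈ 1ℤ
  ≈1-comm r s = ≈-trans (≈-reflexive (ℤ.*-comm s r))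

  ≈-*-transpose : ∀ r s {x y} → s * r ≈ 1ℤ → y ≈ r * x → x ≈ s * y
  ≈-*-transpose r s {x} {y} sr≈1 y≈rx = begin
    x              ≡⟨ ℤ.*-identityˡ x ⟨
    1ℤ * x         ≈⟨ *-cong {s * r} sr≈1 ≈-refl ⟨
    s * r * x      ≡⟨ ℤ.*-assoc s r x ⟩
    s * (r * x)    ≈⟨ *-cong {s} ≈-refl y≈rx ⟨
    s * y          ∎
    where open ≈-Reasoning

  ^-cong : ∀ {x y} k → x ≈ y → x ^ k ≈ y ^ k
  ^-cong zero    x≈y = ≈-refl
  ^-cong (suc k) x≈y = *-cong x≈y (^-cong k x≈y)

  ≈1⇒^≈1 : ∀ {x} k → x ≈ 1ℤ → x ^ k ≈ 1ℤ
  ≈1⇒^≈1 k x≈1 = ≈-trans (^-cong k x≈1) (≈-reflexive (^-zeroˡ k))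

  ^-*-≈1 : ∀ {r A} x → r ^ A ≈ 1ℤ → r ^ (x ℕ.* A) ≈ 1ℤ
  ^-*-≈1 {r} {A} x r^A≈1 =
    ≈-trans (≈-reflexive (trans (cong (r ^_) (ℕ.*-comm x A)) (sym (ℤ.^-*-assoc r A x))))
            (≈1⇒^≈1 x r^A≈1)

  ^-+-≈1 : ∀ {r} d C → r ^ (d ℕ.+ C) ≈ 1ℤ → r ^ C ≈ 1ℤ → r ^ d ≈ 1ℤ
  ^-+-≈1 {r} d C r^[d+C]≈1 r^C≈1 = begin
    r ^ d            ≡⟨ ℤ.*-identityʳ (r ^ d) ⟨
    r ^ d * 1ℤ       ≈⟨ *-cong {r ^ d} ≈-refl r^C≈1 ⟨
    r ^ d * r ^ C    ≡⟨ ℤ.^-distribˡ-+-* r d C ⟨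
    r ^ (d ℕ.+ C)    ≈⟨ r^[d+C]≈1 ⟩
    1ℤ               ∎
    where open ≈-Reasoning

  ^-gcd-≈1 : ∀ {r} A B → r ^ A ≈ 1ℤ → r ^ B ≈ 1ℤ → r ^ gcd A B ≈ 1ℤ
  ^-gcd-≈1 {r} A B r^A≈1 r^B≈1 with Bézout.identity (gcd-GCD A B)
  ... | Bézout.+- x y d+yB≡xA =
    ^-+-≈1 (gcd A B) (y ℕ.* B) (subst (λ e → r ^ e ≈ 1ℤ) (sym d+yB≡xA) (^-*-≈1 x r^A≈1))
           (^-*-≈1 y r^B≈1)
  ... | Bézout.-+ x y d+xA≡yB =
    ^-+-≈1 (gcd A B) (x ℕ.* A) (subst (λ e → r ^ e ≈ 1ℤ) (sym d+xA≡yB) (^-*-≈1 y r^B≈1))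
           (^-*-≈1 x r^A≈1)

  coprime-resp-≈ : ∀ {x y} → x ≈ y → Coprime ∣ x ∣ n → Coprime ∣ y ∣ n
  coprime-resp-≈ {x} {y} (mk≈ n∣x-y) x⊥n {d} (d∣y , d∣n) = x⊥n (∣⇒∣ᵤ d∣x , d∣n)
    where
    d∣x : + d Signed.∣ x
    d∣x = subst (+ d Signed.∣_) (recompose x y)
            (∣m∣n⇒∣m+n (Signed.∣-trans (∣ᵤ⇒∣ d∣n) n∣x-y) (∣ᵤ⇒∣ d∣y))
      where
      recompose : ∀ x y → (x - y) + y ≡ x
      recompose = solve-∀

  unit⇒coprime : ∀ x y → x * y ≈ 1ℤ → Coprime ∣ x ∣ n
  unit⇒coprime x y (mk≈ n∣xy-1) {d} (d∣x , d∣n) = ℕ.∣1⇒≡1 (∣⇒∣ᵤ d∣1)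
    where
    d∣1 : + d Signed.∣ 1ℤ
    d∣1 = subst (+ d Signed.∣_) (cancel (x * y))
            (∣m∣n⇒∣m-n (∣m⇒∣m*n {m = x} y (∣ᵤ⇒∣ d∣x)) (Signed.∣-trans (∣ᵤ⇒∣ d∣n) n∣xy-1))
      where
      cancel : ∀ u → u - (u - 1ℤ) ≡ 1ℤ
      cancel = solve-∀

  *-coprime : ∀ x y → Coprime ∣ x ∣ n → Coprime ∣ y ∣ n → Coprime ∣ x * y ∣ n
  *-coprime x y x⊥n y⊥n = subst (λ k → Coprime k n) (sym (abs-* x y)) (coprime-* x⊥n y⊥n)

  ∏-coprime : ∀ {k} (f : Fin k → ℤ) → (∀ i → Coprime ∣ f i ∣ n) → Coprime ∣ ∏ f ∣ n
  ∏-coprime {zero}  f f⊥n = 1-coprimeTo n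
  ∏-coprime {suc k} f f⊥n =
    *-coprime (f Fin.zero) (∏ (f ∘ Fin.suc)) (f⊥n Fin.zero) (∏-coprime (f ∘ Fin.suc) (f⊥n ∘ Fin.suc))

  *-cancelʳ-coprime : ∀ {x y z} → Coprime ∣ z ∣ n → x * z ≈ y * z → x ≈ y
  *-cancelʳ-coprime {x} {y} {z} z⊥n (mk≈ n∣xz-yz) =
    mk≈ (∣ᵤ⇒∣ (ℤ.coprime-divisor (+ n) z (x - y) (Coprimality.sym z⊥n)
                 (∣⇒∣ᵤ (subst (+ n Signed.∣_) (factor x y z) n∣xz-yz))))
    where
    factor : ∀ x y z → x * z - y * z ≡ z * (x - y)
    factor = solve-∀

  unit? : ∀ k → Dec (gcd k n ≡ 1)
  unit? k = gcd k n ℕ.≟ 1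

  -- unitPart x k is x when k is a unit mod n and 1 otherwise. Euler's product argument then runs
  -- over all residues 0, …, n - 1 (a Fin n) instead of over the units only.
  unitPart : ℤ → ℕ → ℤ
  unitPart x k with unit? k
  ... | yes _ = x
  ... | no  _ = 1ℤ

  unitPart-coprime : ∀ k → Coprime ∣ unitPart (+ k) k ∣ n
  unitPart-coprime k with unit? k
  ... | yes k⊥n = gcd≡1⇒coprime k⊥n
  ... | no  _   = 1-coprimeTo n

  unitPart-*-≈ : ∀ {r s x y} → r * s ≈ 1ℤ → + y ≈ r * + x →
                 unitPart (+ y) y ≈ unitPart r x * unitPart (+ x) x
  unitPart-*-≈ {r} {s} {x} {y} rs≈1 y≈rx with unit? x | unit? y
  ... | yes _   | yes _   = y≈rx
  ... | no  _   | no  _   = ≈-refl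
  ... | yes x⊥n | no  ¬y⊥n = contradiction (coprime⇒gcd≡1 y⊥n) ¬y⊥n
    where
    y⊥n : Coprime y n
    y⊥n = coprime-resp-≈ (≈-sym y≈rx) (*-coprime r (+ x) (unit⇒coprime r s rs≈1) (gcd≡1⇒coprime x⊥n))
  ... | no  ¬x⊥n | yes y⊥n = contradiction (coprime⇒gcd≡1 x⊥n) ¬x⊥n
    where
    sr≈1 : s * r ≈ 1ℤ
    sr≈1 = ≈1-comm r s rs≈1
    x⊥n : Coprime x n
    x⊥n = coprime-resp-≈ (≈-sym (≈-*-transpose r s sr≈1 y≈rx))
            (*-coprime s (+ y) (unit⇒coprime s r sr≈1) (gcd≡1⇒coprime y⊥n))

  count : List ℕ → ℕ
  count = length ∘ filter unit?

  ∏-unitPart : ∀ x k (f : ℕ → ℕ) →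
               ∏ (λ (i : Fin k) → unitPart x (f (toℕ i))) ≡ x ^ count (applyUpTo f k)
  ∏-unitPart x zero    f = refl
  ∏-unitPart x (suc k) f with unit? (f 0)
  ... | yes f0⊥n = trans (cong (x *_) (∏-unitPart x k (f ∘ suc)))
                     (cong (λ l → x ^ length l) (sym (filter-accept unit? {f 0} {applyUpTo (f ∘ suc) k} f0⊥n)))
  ... | no  ¬f0⊥n = trans (ℤ.*-identityˡ _) (trans (∏-unitPart x k (f ∘ suc))
                     (cong (λ l → x ^ length l) (sym (filter-reject unit? {f 0} {applyUpTo (f ∘ suc) k} ¬f0⊥n))))

  count-++ : ∀ xs ys → count (xs ++ ys) ≡ count xs ℕ.+ count ys
  count-++ xs ys = trans (cong length (filter-++ unit? xs ys)) (length-++ (filter unit? xs))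

  count[unit] : ∀ k → gcd k n ≡ 1 → count [ k ] ≡ 1
  count[unit] k k⊥n = cong length (filter-accept unit? {k} {[]} k⊥n)

  count[nonunit] : ∀ k → ¬ gcd k n ≡ 1 → count [ k ] ≡ 0
  count[nonunit] k ¬k⊥n = cong length (filter-reject unit? {k} {[]} ¬k⊥n)

  count[]-cong : ∀ {a b} → gcd a n ≡ gcd b n → count [ a ] ≡ count [ b ]
  count[]-cong {a} {b} eq with unit? a | unit? b
  ... | yes a⊥n | yes b⊥n = trans (count[unit] a a⊥n) (sym (count[unit] b b⊥n))
  ... | no  ¬a⊥n | no  ¬b⊥n = trans (count[nonunit] a ¬a⊥n) (sym (count[nonunit] b ¬b⊥n))
  ... | yes a⊥n | no  ¬b⊥n = contradiction (trans (sym eq) a⊥n) ¬b⊥n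
  ... | no  ¬a⊥n | yes b⊥n = contradiction (trans eq b⊥n) ¬a⊥n

  -- φ counts the units among 1, …, n, the residues are 0, …, n - 1; 0 and n have the same gcd with n.
  count-upTo≡φ : count (upTo n) ≡ φ n
  count-upTo≡φ = ℕ.+-cancelʳ-≡ (count [ n ]) _ _ (begin
    count (upTo n) ℕ.+ count [ n ]           ≡⟨ count-++ (upTo n) [ n ] ⟨
    count (upTo n ++ [ n ])                  ≡⟨ cong count (upTo-∷ʳ n) ⟩
    count ([ 0 ] ++ applyUpTo suc n)         ≡⟨ count-++ [ 0 ] (applyUpTo suc n) ⟩
    count [ 0 ] ℕ.+ count (applyUpTo suc n)  ≡⟨ cong₂ ℕ._+_ count[n]≡count[0] φ≡count ⟨
    count [ n ] ℕ.+ φ n                      ≡⟨ ℕ.+-comm (count [ n ]) (φ n) ⟩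
    φ n ℕ.+ count [ n ]                      ∎)
    where
    open ≡-Reasoning
    φ≡count : φ n ≡ count (applyUpTo suc n)
    φ≡count = cong count (map-applyUpTo id suc n)
    count[n]≡count[0] : count [ n ] ≡ count [ 0 ]
    count[n]≡count[0] = count[]-cong {n} {0}
      (trans (ℕ.∣-antisym (gcd[m,n]∣n n n) (gcd-greatest ℕ.∣-refl ℕ.∣-refl)) (sym (gcd-identityˡ n)))

  module _ .{{_ : NonZero n}} where

    %ℕ-≈ : ∀ x → + (x %ℕ n) ≈ x
    %ℕ-≈ x = mk≈ (divides (- (x /ℕ n)) (begin
      + (x %ℕ n) - x                               ≡⟨ cong (_-_ (+ (x %ℕ n))) (a≡a%ℕn+[a/ℕn]*n x n) ⟩
      + (x %ℕ n) - (+ (x %ℕ n) + (x /ℕ n) * + n)  ≡⟨ cancel (+ (x %ℕ n)) (x /ℕ n) (+ n) ⟩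
      - (x /ℕ n) * + n                             ∎))
      where
      open ≡-Reasoning
      cancel : ∀ r q k → r - (r + q * k) ≡ - q * k
      cancel = solve-∀

    residue-unique : ∀ {x y} → x < n → y < n → + x ≈ + y → x ≡ y
    residue-unique {x} {y} x<n y<n (mk≈ n∣x-y) =
      +-injective (i-j≡0⇒i≡j (+ x) (+ y) (∣i∣≡0⇒i≡0 (<∧∣⇒≡0 distance<n (∣⇒∣ᵤ n∣x-y))))
      where
      distance<n : ∣ + x - + y ∣ < n
      distance<n = subst (_< n) (cong ∣_∣ (sym (m-n≡m⊖n x y)))
                     (ℕ.≤-<-trans (∣m⊝n∣≤m⊔n x y) (ℕ.⊔-pres-<m x<n y<n))
      <∧∣⇒≡0 : ∀ {k} → k < n → n ℕ.∣ k → k ≡ 0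
      <∧∣⇒≡0 {zero}  _   _   = refl
      <∧∣⇒≡0 {suc k} k<n n∣k = contradiction n∣k (ℕ.>⇒∤ k<n)

    ×-residue : ℤ → Fin n → Fin n
    ×-residue r i = fromℕ< (n%ℕd<d (r * + toℕ i) n)

    ×-residue-≈ : ∀ r i → + toℕ (×-residue r i) ≈ r * + toℕ i
    ×-residue-≈ r i =
      subst (λ k → + k ≈ r * + toℕ i) (sym (toℕ-fromℕ< (n%ℕd<d (r * + toℕ i) n))) (%ℕ-≈ (r * + toℕ i))

    ×-residue-inverse : ∀ r s → s * r ≈ 1ℤ → ∀ i → ×-residue s (×-residue r i) ≡ i
    ×-residue-inverse r s sr≈1 i = toℕ-injective (residue-unique (toℕ<n _) (toℕ<n i)
      (≈-trans (×-residue-≈ s (×-residue r i)) (≈-sym (≈-*-transpose r s sr≈1 (×-residue-≈ r i)))))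

    ×-residue-permutation : ∀ r s → r * s ≈ 1ℤ → Permutation n n
    ×-residue-permutation r s rs≈1 = permutation (×-residue r) (×-residue s)
      (×-residue-inverse s r rs≈1) (×-residue-inverse r s (≈1-comm r s rs≈1))

    euler : ∀ {r s} → r * s ≈ 1ℤ → r ^ φ n ≈ 1ℤ
    euler {r} {s} rs≈1 = *-cancelʳ-coprime (∏-coprime h (unitPart-coprime ∘ toℕ)) (begin
      r ^ φ n * ∏ h             ≡⟨ cong (_* ∏ h) ∏g≡r^φ ⟨
      ∏ g * ∏ h                 ≈⟨ ∑-distrib-+ g h ⟨
      ∏ (λ i → g i * h i)       ≈⟨ sum-cong-≋ h∘π≈g*h ⟨
      ∏ (λ i → h (π ⟨$⟩ʳ i))    ≈⟨ ∑-permute h π ⟨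
      ∏ h                       ≡⟨ ℤ.*-identityˡ (∏ h) ⟨
      1ℤ * ∏ h                  ∎)
      where
      open ≈-Reasoning
      h g : Fin n → ℤ
      h i = unitPart (+ toℕ i) (toℕ i)
      g i = unitPart r (toℕ i)
      π : Permutation n n
      π = ×-residue-permutation r s rs≈1
      h∘π≈g*h : ∀ i → h (π ⟨$⟩ʳ i) ≈ g i * h i
      h∘π≈g*h i = unitPart-*-≈ {r} {s} {toℕ i} rs≈1 (×-residue-≈ r i)
      ∏g≡r^φ : ∏ g ≡ r ^ φ n
      ∏g≡r^φ = trans (∏-unitPart r n id) (cong (r ^_) count-upTo≡φ)

    euler-^ : ∀ {b} N .{{_ : NonZero N}} → b ^ N ≈ 1ℤ → b ^ φ n ≈ 1ℤ
    euler-^ {b} (suc N) b^N≈1 = euler {b} {b ^ N} b^N≈1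

open import Data.Nat using (_*_; _+_; _∸_)
open import Data.Nat.Divisibility using (_∣_)
open import Data.Integer using (ℤ; 1ℤ)

prime-factor : ∀ {k} → 1 < k → ∃ λ p → Prime p × p ∣ k
prime-factor {k@(suc _)} 1<k with factorise k
... | record { factors = [] ; isFactorisation = k≡1 } = contradiction (sym k≡1) (ℕ.<⇒≢ 1<k)
... | record { factors = p ∷ _ ; isFactorisation = k≡Π ; factorsPrime = p-prime ∷ _ } =
  p , p-prime , subst (p ∣_) (sym k≡Π) (ℕ.m∣m*n _)

no-common-prime⇒coprime : ∀ {m t} → m ≢ 0 → (∀ {p} → Prime p → p ∣ m → ¬ p ∣ t) → Coprime m t
no-common-prime⇒coprime m≢0 _ {zero}       (0∣m , _) = contradiction (ℕ.0∣⇒≡0 0∣m) m≢0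
no-common-prime⇒coprime _   _ {suc zero}   _         = refl
no-common-prime⇒coprime _ disjoint {k@(suc (suc _))} (k∣m , k∣t)
  with p , p-prime , p∣k ← prime-factor {k} (s≤s (s≤s z≤n)) =
  contradiction (ℕ.∣-trans p∣k k∣t) (disjoint p-prime (ℕ.∣-trans p∣k k∣m))

LucasWitnesses : ℕ → ℕ → ℕ → Set
LucasWitnesses n N m = ∀ (q : ℕ) (pq : Prime q) → q ∣ m →
  ∃ λ (b : ℤ) → (b ℤ.^ N) ≡ ℤ.+ 1 [modℤ n ] × ¬ ((b ℤ.^ (N /ᵖ q) pq) ≡ ℤ.+ 1 [modℤ n ])

witnesses⇒∣φ : ∀ {n N m} .{{_ : NonZero n}} .{{_ : NonZero N}} → m ∣ N → LucasWitnesses n N m → m ∣ φ n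
witnesses⇒∣φ {n} {N} {m} m∣N witnesses =
  ℕ.∣-trans (Coprimality.coprime-divisor m⊥t m∣t*d) (gcd[m,n]∣n N (φ n))
  where
  open Congruence n
  d t : ℕ
  d = gcd N (φ n)
  t = ℕ.quotient (gcd[m,n]∣m N (φ n))
  N≡d*t : N ≡ d * t
  N≡d*t = ℕ.m∣n⇒n≡m*quotient (gcd[m,n]∣m N (φ n))
  m∣t*d : m ∣ t * d
  m∣t*d = subst (m ∣_) (trans N≡d*t (ℕ.*-comm d t)) m∣N
  ^N≈1⇒^d≈1 : ∀ {b} → b ℤ.^ N ≈ 1ℤ → b ℤ.^ d ≈ 1ℤ
  ^N≈1⇒^d≈1 b^N≈1 = ^-gcd-≈1 N (φ n) b^N≈1 (euler-^ N b^N≈1)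
  no-prime-divides-both : ∀ {q} → Prime q → q ∣ m → ¬ q ∣ t
  no-prime-divides-both {q} pq q∣m q∣t with b , b^N≡1 , b^[N/q]≢1 ← witnesses q pq q∣m =
    b^[N/q]≢1 (≈⇒modℤ (begin
      b ℤ.^ (N /ᵖ q) pq      ≡⟨ cong (b ℤ.^_) N/q≡d*[t/q] ⟩
      b ℤ.^ (d * (t / q))    ≡⟨ ℤ.^-*-assoc b d (t / q) ⟨
      (b ℤ.^ d) ℤ.^ (t / q)  ≈⟨ ≈1⇒^≈1 (t / q) (^N≈1⇒^d≈1 (modℤ⇒≈ b^N≡1)) ⟩
      1ℤ                     ∎))
    where
    open ≈-Reasoning
    instance
      q≢0 : NonZero q
      q≢0 = prime⇒nonZero pq
    N/q≡d*[t/q] : (N /ᵖ q) pq ≡ d * (t / q)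
    N/q≡d*[t/q] = trans (cong (_/ q) N≡d*t) (*-/-assoc d q∣t)
  m≢0 : m ≢ 0
  m≢0 refl = ℕ.≢-nonZero⁻¹ N (ℕ.0∣⇒≡0 m∣N)
  m⊥t : Coprime m t
  m⊥t = no-common-prime⇒coprime m≢0 no-prime-divides-both

theorem4p2 : HypothesisH →
    ∀ (a m p : ℕ) → 1 ≤ a → 1 < m → LeastPrimeDivisor p m → a < p →
    (∀ (q : ℕ) (pq : Prime q) → q ∣ m →
      ∃ λ (b : ℤ.ℤ) →
        (b ℤ.^ (a * m + 1 ∸ 1)) ≡ ℤ.+ 1 [modℤ (a * m + 1) ]
        × ¬ ((b ℤ.^ ((a * m + 1 ∸ 1) /ᵖ q) pq) ≡ ℤ.+ 1 [modℤ (a * m + 1) ])) →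
    Prime (a * m + 1)
theorem4p2 H a m p 1≤a 1<m lpd a<p witnesses =
  H a m p 1≤a 1<m lpd a<p (witnesses⇒∣φ {{n≢0}} {{N≢0}} m∣N witnesses)
  where
  N≡a*m : a * m + 1 ∸ 1 ≡ a * m
  N≡a*m = ℕ.m+n∸n≡m (a * m) 1
  n≢0 : NonZero (a * m + 1)
  n≢0 = subst NonZero (ℕ.+-comm 1 (a * m)) _
  N≢0 : NonZero (a * m + 1 ∸ 1)
  N≢0 = subst NonZero (sym N≡a*m) (ℕ.m*n≢0 a m {{ℕ.>-nonZero 1≤a}} {{ℕ.>-nonZero (ℕ.<-trans ℕ.z<s 1<m)}})
  m∣N : m ∣ a * m + 1 ∸ 1
  m∣N = subst (m ∣_) (sym N≡a*m) (ℕ.n∣m*n a)
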